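{- There exists a DES $\delta=(E,\#,\mapsto)$ for which there is no SES $\sigma=(E,\#',\to,\triangleright)$ with the same set of events $E$ such that $\mathrm{traces}(\delta)=\mathrm{traces}(\sigma)$. For instance, $\delta=(\{a,b,c,d,e\},\emptyset,\mapsto)$ with $\mapsto\ =\{\{x,y\}\mapsto e\mid x,y\in\{a,b,c,d\},\ x\neq y\}$ is such a DES.
   Context: A Dual Event Structure (DES) is a triple $\delta=(E,\#,\mapsto)$ with $E$ a set of events, $\#\subseteq E\times E$ irreflexive and symmetric, and $\mapsto\ \subseteq 2^E\times E$ (bundles $X\mapsto e$). A trace of $\delta$ is a finite sequence $e_1\cdots e_n$ of pairwise distinct events of $E$ with $\neg(e_i\#e_j)$ for all $i,j$ and $X\cap\{e_1,\dots,e_{i-1}\}\neq\emptyset$ for every $i$ and every bundle $X\mapsto e_i$. A shrinking-causality event structure (SES) is a tuple $\sigma=(E,\#,\to,\triangleright)$ with $\#\subseteq E\times E$ irreflexive and symmetric, $\to\ \subseteq E\times E$ (initial causality), $\triangleright\subseteq E^3$; write $[c\to t]\triangleright d$ for $(c,t,d)\in\triangleright$, required to imply $c\to t$. With $ic(e)=\{e'\mid e'\to e\}$ and $dc(H,e)=\{e'\mid\exists d\in H.\ [e'\to e]\triangleright d\}$, a trace of $\sigma$ is a finite sequence $e_1\cdots e_n$ of pairwise distinct events of $E$ with $\neg(e_i\#e_j)$ for all $i,j$ and $ic(e_i)\setminus dc(\{e_1,\dots,e_{i-1}\},e_i)\subseteq\{e_1,\dots,e_{i-1}\}$ for all $i$.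 -}

module Defs where


open import Data.Nat using (ℕ; _<_)
open import Data.Fin using (Fin; zero; suc; toℕ)
open import Data.List using (List; []; _∷_; length; lookup; take)
open import Data.List.Relation.Unary.Unique.Propositional using (Unique)
open import Data.List.Membership.Propositional using (_∈_; _∉_)
open import Data.Product using (Σ; ∃; _×_; _,_)
open import Data.Empty using (⊥)
open import Data.Sum using (_⊎_)
open import Level using (Lift)
import Level
open import Relation.Nullary using (¬_)
open import Relation.Binary.PropositionalEquality using (_≡_; _≢_)

Subset : Set → Set₁
Subset E = E → Set

record DES (E : Set) : Set₂ where
  field
    _#_      : E → E → Set
    #-irrefl : ∀ x → ¬ (x # x)
    #-sym    : ∀ x y → x # y → y # x
    _↦_      : Subset E → E → Set₁

record SES (E : Set) : Set₁ where
  field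
    _#_      : E → E → Set
    #-irrefl : ∀ x → ¬ (x # x)
    #-sym    : ∀ x y → x # y → y # x
    _⇒_      : E → E → Set
    drop     : E → E → E → Set             -- drop c t d  means  [c → t] ▷ d
    drop⇒    : ∀ c t d → drop c t d → c ⇒ t

ConflictFree : {E : Set} → (E → E → Set) → List E → Set
ConflictFree _#_ t = ∀ {x y} → x ∈ t → y ∈ t → ¬ (x # y)

IsTraceD : {E : Set} → DES E → List E → Set₁
IsTraceD {E} δ t =
  Unique t × ConflictFree _#_ t ×
  (∀ (i : Fin (length t)) (X : Subset E) → X ↦ lookup t i →
     Σ E λ x → X x × x ∈ take (toℕ i) t)
  where open DES δ

-- Traces of an SES: distinct, conflict-free, and
-- ic(eᵢ) ∖ dc({e₁..e_{i-1}}, eᵢ) ⊆ {e₁..e_{i-1}}.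
IsTraceS : {E : Set} → SES E → List E → Set
IsTraceS {E} σ t =
  Unique t × ConflictFree _#_ t ×
  (∀ (i : Fin (length t)) (c : E) → c ⇒ lookup t i →
     ¬ (Σ E λ d → d ∈ take (toℕ i) t × drop c (lookup t i) d) →
     c ∈ take (toℕ i) t)
  where open SES σ

SameTraces : {E : Set} → DES E → SES E → Set₁
SameTraces δ σ = ∀ t → (IsTraceD δ t → IsTraceS σ t) × (IsTraceS σ t → IsTraceD δ t)

-- The concrete example: E = {a,b,c,d,e} = Fin 5 with e = index 4,
-- empty conflict, and bundles {x,y} ↦ e for distinct x,y ∈ {a,b,c,d}.
e₅ : Fin 5
e₅ = suc (suc (suc (suc zero)))

exBundle : Subset (Fin 5) → Fin 5 → Set₁
exBundle X f = Lift (Level.suc Level.zero) (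
  (f ≡ e₅) × Σ (Fin 5) λ x → Σ (Fin 5) λ y →
    x ≢ e₅ × y ≢ e₅ × x ≢ y × (∀ z → (X z → (z ≡ x) ⊎ (z ≡ y)) × ((z ≡ x) ⊎ (z ≡ y) → X z)))


exDES : DES (Fin 5)
exDES = record
  { _#_ = λ _ _ → ⊥
  ; #-irrefl = λ _ ()
  ; #-sym = λ _ _ ()
  ; _↦_ = exBundle
  }

module Submission where

-- Enabling e in exDES is a purely "counting" condition: e may occur
-- once at least three of a, b, c, d have occurred.  Suppose σ is an SES with the same
-- traces and fix one of the six pairs P = {p, q} of {a,b,c,d}.
--   * p q e is not a trace, although p q t e is one for every other t ∈ {a,b,c,d}.
--     Since the first two steps of p q t e are steps of p q e, the event e must be
--     disabled after p q, i.e. there is a cause c_P ⇒ e with c_P ∉ P that no event of P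
--     drops (a "blocker" of e after P).
--   * As e is enabled after p q t, each such t ≠ c_P must drop [c_P ⇒ e].
-- So c_P is dropped exactly by the events of {a,b,c,d} outside P (and not equal to c_P).
-- Two different pairs therefore have different blockers, but there are six pairs and
-- only five events: the pigeonhole principle gives the contradiction.  Blockers only
-- exist up to double negation (the drop relation of σ is arbitrary), which suffices
-- since the goal is ⊥.

open import Defs
open import Data.Product using (Σ; ∃; ∃₂; _×_; _,_; proj₁; proj₂)
open import Data.Fin using (Fin; zero; suc; toℕ)
open import Relation.Nullary using (¬_)

open import Data.Empty using (⊥; ⊥-elim)
open import Data.Sum using (_⊎_; inj₁; inj₂; [_,_]′)
import Data.Nat as ℕ
open import Data.Nat.Properties using (n<1+n)
open import Data.Fin.Properties using (_≟_; all?; any?; pigeonhole; <⇒≢)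
open import Data.List using (List; []; _∷_; _++_; lookup; take)
open import Data.List.Relation.Unary.All using ([]; _∷_)
open import Data.List.Relation.Unary.AllPairs using ([]; _∷_)
open import Data.List.Relation.Unary.Any using (here; there)
  renaming (any? to anyInList?)
open import Data.List.Membership.Propositional using (_∈_; _∉_)
open import Data.List.Membership.Propositional.Properties using (∈-++⁻)
open import Data.List.Membership.DecPropositional (_≟_ {5}) using (_∈?_; _∉?_)
open import Relation.Nullary using (¬?; yes; no)
open import Relation.Nullary.Decidable using (Dec; from-yes; _→-dec_; _⊎-dec_; _×-dec_)
open import Relation.Binary.Definitions using (DecidableEquality)
open import Relation.Binary.PropositionalEquality using (_≡_; _≢_; refl; sym; subst)
open import Level using (lift)
open import Function using (id; _∘_)

¬¬-∀-Fin : ∀ {n} {P : Fin n → Set} → (∀ i → ¬ ¬ P i) → ¬ ¬ (∀ i → P i)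
¬¬-∀-Fin {ℕ.zero} _ k = k (λ ())
¬¬-∀-Fin {ℕ.suc n} {P} h k =
  h zero λ p₀ → ¬¬-∀-Fin {P = P ∘ suc} (h ∘ suc) λ ps →
    k λ { zero → p₀ ; (suc i) → ps i }

module _ {E : Set} (σ : SES E) where
  open SES σ

  Enabled : List E → E → Set
  Enabled h e = ∀ c → c ⇒ e → ¬ (Σ E λ d → d ∈ h × drop c e d) → c ∈ h

  Blocks : List E → E → E → Set
  Blocks h e c = c ⇒ e × c ∉ h × (∀ d → d ∈ h → ¬ drop c e d)

  enabled-unless-blocked : DecidableEquality E → ∀ h e → (∀ c → ¬ Blocks h e c) → Enabled h e
  enabled-unless-blocked _≟ᴱ_ h e unblocked c c⇒e undropped with anyInList? (c ≟ᴱ_) h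
  ... | yes c∈h = c∈h
  ... | no c∉h = ⊥-elim (unblocked c (c⇒e , c∉h , λ d d∈h dr → undropped (d , d∈h , dr)))

  blocker-dropped : ∀ h t e c → Enabled (h ++ t ∷ []) e → Blocks h e c → c ≢ t → ¬ ¬ drop c e t
  blocker-dropped h t e c enabled (c⇒e , c∉h , undropped-by-h) c≢t ¬dropped =
    [ c∉h , (λ { (here c≡t) → c≢t c≡t }) ]′ (∈-++⁻ h (enabled c c⇒e undropped))
    where
    undropped : ¬ (Σ E λ d → d ∈ h ++ t ∷ [] × drop c e d)
    undropped (d , d∈ , dr) =
      [ (λ d∈h → undropped-by-h d d∈h dr) , (λ { (here refl) → ¬dropped dr }) ]′ (∈-++⁻ h d∈)

  skip-third : ∀ {p q t e} → IsTraceS σ (p ∷ q ∷ t ∷ e ∷ []) → Enabled (p ∷ q ∷ []) e →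
               IsTraceS σ (p ∷ q ∷ e ∷ [])
  skip-third {p} {q} {t} {e}
    (((p≢q ∷ _ ∷ p≢e ∷ []) ∷ (_ ∷ q≢e ∷ []) ∷ _) , conflict-free , enabled) e-enabled =
    ((p≢q ∷ p≢e ∷ []) ∷ (q≢e ∷ []) ∷ [] ∷ []) ,
    (λ x∈ y∈ → conflict-free (sub x∈) (sub y∈)) , enabled′
    where
    sub : ∀ {x} → x ∈ p ∷ q ∷ e ∷ [] → x ∈ p ∷ q ∷ t ∷ e ∷ []
    sub (here x≡p) = here x≡p
    sub (there (here x≡q)) = there (here x≡q)
    sub (there (there x∈e)) = there (there (there x∈e))
    enabled′ : ∀ i → Enabled (take (toℕ i) (p ∷ q ∷ e ∷ [])) (lookup (p ∷ q ∷ e ∷ []) i)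
    enabled′ zero = enabled zero
    enabled′ (suc zero) = enabled (suc zero)
    enabled′ (suc (suc zero)) = e-enabled

MeetsEveryPair : List (Fin 5) → Set
MeetsEveryPair h = ∀ x y → x ≢ e₅ → y ≢ e₅ → x ≢ y → x ∈ h ⊎ y ∈ h

meets-every-pair? : ∀ h → Dec (MeetsEveryPair h)
meets-every-pair? h = all? λ x → all? λ y →
  ¬? (x ≟ e₅) →-dec ¬? (y ≟ e₅) →-dec ¬? (x ≟ y) →-dec (x ∈? h ⊎-dec y ∈? h)

opaque
  three-meet-every-pair : ∀ p q t → p ≢ q → p ≢ e₅ → q ≢ e₅ → t ∉ p ∷ q ∷ [] → t ≢ e₅ →
                          MeetsEveryPair (p ∷ q ∷ t ∷ [])
  three-meet-every-pair = from-yes (all? λ p → all? λ q → all? λ t →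
    ¬? (p ≟ q) →-dec ¬? (p ≟ e₅) →-dec ¬? (q ≟ e₅) →-dec t ∉? (p ∷ q ∷ []) →-dec
    ¬? (t ≟ e₅) →-dec meets-every-pair? (p ∷ q ∷ t ∷ []))

opaque
  avoided-pair : ∀ p q → p ≢ q → p ≢ e₅ → q ≢ e₅ →
                 ∃₂ λ r s → r ≢ s × r ≢ e₅ × s ≢ e₅ × r ∉ p ∷ q ∷ [] × s ∉ p ∷ q ∷ []
  avoided-pair = from-yes (all? λ p → all? λ q →
    ¬? (p ≟ q) →-dec ¬? (p ≟ e₅) →-dec ¬? (q ≟ e₅) →-dec any? λ r → any? λ s →
    ¬? (r ≟ s) ×-dec ¬? (r ≟ e₅) ×-dec ¬? (s ≟ e₅) ×-dec
    r ∉? (p ∷ q ∷ []) ×-dec s ∉? (p ∷ q ∷ []))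

bundle-target : ∀ {X f} → exBundle X f → f ≡ e₅
bundle-target (lift (f≡e , _)) = f≡e

meets-bundle : ∀ {h X f} → MeetsEveryPair h → exBundle X f → Σ (Fin 5) λ x → X x × x ∈ h
meets-bundle meets (lift (_ , x , y , x≢e , y≢e , x≢y , X≐xy))
  with meets x y x≢e y≢e x≢y
... | inj₁ x∈h = x , proj₂ (X≐xy x) (inj₁ refl) , x∈h
... | inj₂ y∈h = y , proj₂ (X≐xy y) (inj₂ refl) , y∈h

record Pair : Set where
  constructor pair
  field
    fst snd : Fin 5
    fst≢snd : fst ≢ snd
    fst≢e : fst ≢ e₅
    snd≢e : snd ≢ e₅

  members : List (Fin 5)
  members = fst ∷ snd ∷ []

  member≢e : ∀ {t} → t ∈ members → t ≢ e₅
  member≢e (here refl) = fst≢e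
  member≢e (there (here refl)) = snd≢e

  trace-with-third : ∀ t → t ∉ members → t ≢ e₅ → IsTraceD exDES (fst ∷ snd ∷ t ∷ e₅ ∷ [])
  trace-with-third t t∉ t≢e =
    ((fst≢snd ∷ fst≢t ∷ fst≢e ∷ []) ∷ (snd≢t ∷ snd≢e ∷ []) ∷ (t≢e ∷ []) ∷ [] ∷ []) ,
    (λ _ _ ()) , bundles
    where
    fst≢t : fst ≢ t
    fst≢t fst≡t = t∉ (here (sym fst≡t))
    snd≢t : snd ≢ t
    snd≢t snd≡t = t∉ (there (here (sym snd≡t)))
    bundles : ∀ i X → exBundle X (lookup (fst ∷ snd ∷ t ∷ e₅ ∷ []) i) →
              Σ (Fin 5) λ x → X x × x ∈ take (toℕ i) (fst ∷ snd ∷ t ∷ e₅ ∷ [])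
    bundles zero _ b = ⊥-elim (fst≢e (bundle-target b))
    bundles (suc zero) _ b = ⊥-elim (snd≢e (bundle-target b))
    bundles (suc (suc zero)) _ b = ⊥-elim (t≢e (bundle-target b))
    bundles (suc (suc (suc zero))) _ b =
      meets-bundle (three-meet-every-pair fst snd t fst≢snd fst≢e snd≢e t∉ t≢e) b

  -- p q e is not a trace of exDES: the bundle of a pair avoiding {p,q} is not met.
  no-trace : ¬ IsTraceD exDES (fst ∷ snd ∷ e₅ ∷ [])
  no-trace (_ , _ , bundles)
    with avoided-pair fst snd fst≢snd fst≢e snd≢e
  ... | r , s , r≢s , r≢e , s≢e , r∉ , s∉
    with bundles (suc (suc zero)) (λ z → z ≡ r ⊎ z ≡ s)
                 (lift (refl , r , s , r≢e , s≢e , r≢s , λ _ → id , id))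
  ... | _ , inj₁ refl , r∈ = r∉ r∈
  ... | _ , inj₂ refl , s∈ = s∉ s∈

open Pair using (members; member≢e)

module _ (σ : SES (Fin 5)) (same : SameTraces exDES σ) where
  open SES σ

  PairBlocker : Pair → Fin 5 → Set
  PairBlocker P c = Blocks σ (members P) e₅ c ×
                    (∀ t → t ∉ members P → t ≢ e₅ → t ≢ c → ¬ ¬ drop c e₅ t)

  pair-blocker : ∀ P → ¬ ¬ ∃ (PairBlocker P)
  pair-blocker P no-blocker = disabled λ c blocks →
    no-blocker (c , blocks , λ t t∉ t≢e t≢c →
      blocker-dropped σ (members P) t e₅ c (enabled-after-third t t∉ t≢e) blocks (t≢c ∘ sym))
    where
    open Pair P using (fst; snd; fst≢snd; fst≢e; snd≢e; trace-with-third; no-trace)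
    traceS : ∀ t → t ∉ members P → t ≢ e₅ → IsTraceS σ (fst ∷ snd ∷ t ∷ e₅ ∷ [])
    traceS t t∉ t≢e = proj₁ (same _) (trace-with-third t t∉ t≢e)
    enabled-after-third : ∀ t → t ∉ members P → t ≢ e₅ → Enabled σ (fst ∷ snd ∷ t ∷ []) e₅
    enabled-after-third t t∉ t≢e = proj₂ (proj₂ (traceS t t∉ t≢e)) (suc (suc (suc zero)))
    disabled : ¬ (∀ c → ¬ Blocks σ (members P) e₅ c)
    disabled unblocked with avoided-pair fst snd fst≢snd fst≢e snd≢e
    ... | r , _ , _ , r≢e , _ , r∉ , _ =
      no-trace (proj₂ (same _) (skip-third σ (traceS r r∉ r≢e)
                                 (enabled-unless-blocked σ _≟_ (members P) e₅ unblocked)))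

  -- A blocker determines its pair: an event of Q outside P would both drop and not drop it.
  blocker-determines-pair : ∀ {P Q c t} → PairBlocker P c → PairBlocker Q c →
                            t ∈ members Q → t ∉ members P → ⊥
  blocker-determines-pair {Q = Q} (_ , dropped-outside-P) ((_ , c∉Q , undropped-by-Q) , _) t∈Q t∉P =
    dropped-outside-P _ t∉P (member≢e Q t∈Q) (λ { refl → c∉Q t∈Q }) (undropped-by-Q _ t∈Q)

a b c d : Fin 5
a = zero
b = suc zero
c = suc (suc zero)
d = suc (suc (suc zero))

pairs : Fin 6 → Pair
pairs zero = pair a b (λ ()) (λ ()) (λ ())
pairs (suc zero) = pair a c (λ ()) (λ ()) (λ ())
pairs (suc (suc zero)) = pair a d (λ ()) (λ ()) (λ ())
pairs (suc (suc (suc zero))) = pair b c (λ ()) (λ ()) (λ ())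
pairs (suc (suc (suc (suc zero)))) = pair b d (λ ()) (λ ()) (λ ())
pairs (suc (suc (suc (suc (suc zero))))) = pair c d (λ ()) (λ ()) (λ ())

opaque
  pairs-differ : ∀ i j → i ≢ j → ∃ λ t → t ∈ members (pairs j) × t ∉ members (pairs i)
  pairs-differ = from-yes (all? λ i → all? λ j → ¬? (i ≟ j) →-dec
    any? λ t → t ∈? members (pairs j) ×-dec t ∉? members (pairs i))

-- No SES has the traces of exDES: six pairs cannot have pairwise distinct blockers in Fin 5.
no-equivalent-SES : ¬ Σ (SES (Fin 5)) (λ σ → SameTraces exDES σ)
no-equivalent-SES (σ , same) = ¬¬-∀-Fin (pair-blocker σ same ∘ pairs) blockers-collide
  where
  blockers-collide : (∀ i → ∃ (PairBlocker σ same (pairs i))) → ⊥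
  blockers-collide blocker
    with pigeonhole (n<1+n 5) (proj₁ ∘ blocker)
  ... | i , j , i<j , same-blocker
    with pairs-differ i j (<⇒≢ i<j)
  ... | t , t∈j , t∉i =
    blocker-determines-pair σ same {pairs i} {pairs j} (proj₂ (blocker i))
      (subst (PairBlocker σ same (pairs j)) (sym same-blocker) (proj₂ (blocker j))) t∈j t∉i

lemma6 : Σ Set (λ E → Σ (DES E) (λ δ → ¬ Σ (SES E) (λ σ → SameTraces δ σ)))
    × ¬ Σ (SES (Fin 5)) (λ σ → SameTraces exDES σ)
lemma6 = (Fin 5 , exDES , no-equivalent-SES) , no-equivalent-SES
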